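{- For all $A:\mathsf{Type}$ and $B:A\to\mathsf{Type}$, the map $\Sigma\text{ -isolate}_{A,B}:\sum_{a:A^{\circ}}(B(a))^{\circ}\to(\sum_{a:A}B(a))^{\circ}$ is an embedding.
   Context: Work in Homotopy Type Theory with a univalent universe. A point $a:A$ is isolated if $a=b$ is decidable for all $b:A$; $A^{\circ}$ is the subtype of isolated points. The map $\Sigma\text{ -isolate}_{A,B}$ sends a pair of isolated points $(a,b)$ (with $a$ isolated in $A$ and $b$ isolated in $B(a)$) to $(a,b)$, which is isolated in $\sum_{a:A}B(a)$. -}

{-# OPTIONS --without-K #-}
module Defs where

open import Level using (Level; _⊔_; Setω)
open import Data.Product using (Σ; _,_; proj₁; proj₂; Σ-syntax)
open import Data.Empty using (⊥-elim)
open import Relation.Nullary using (Dec; yes; no; ¬_)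
open import Relation.Binary.PropositionalEquality
  using (_≡_; refl; sym; trans; cong; subst; trans-symˡ)
open import Axiom.Extensionality.Propositional using (Extensionality)

-- Function extensionality at all universe levels
-- (a consequence of the univalent universe assumed in the paper).
FunExt : Setω
FunExt = ∀ {ℓ ℓ'} → Extensionality ℓ ℓ'

isContr : ∀ {ℓ} → Set ℓ → Set ℓ
isContr X = Σ X λ c → ∀ x → c ≡ x

fiber : ∀ {ℓ ℓ'} {X : Set ℓ} {Y : Set ℓ'} → (X → Y) → Y → Set (ℓ ⊔ ℓ')
fiber {X = X} f y = Σ X λ x → f x ≡ y

isEquiv : ∀ {ℓ ℓ'} {X : Set ℓ} {Y : Set ℓ'} → (X → Y) → Set (ℓ ⊔ ℓ')
isEquiv {Y = Y} f = ∀ (y : Y) → isContr (fiber f y)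

isEmbedding : ∀ {ℓ ℓ'} {X : Set ℓ} {Y : Set ℓ'} → (X → Y) → Set (ℓ ⊔ ℓ')
isEmbedding {X = X} f = ∀ (x x' : X) → isEquiv (cong f {x} {x'})

isIsolated : ∀ {ℓ} {A : Set ℓ} → A → Set ℓ
isIsolated {A = A} a = ∀ (b : A) → Dec (a ≡ b)

_° : ∀ {ℓ} → Set ℓ → Set ℓ
A ° = Σ A isIsolated

-- Local Hedberg: loops at an isolated point are trivial.
module _ {ℓ} {A : Set ℓ} {a : A} (i : isIsolated a) where
  private
    nf : ∀ {x} → a ≡ x → a ≡ x
    nf {x} q with i x
    ... | yes r = r
    ... | no n = ⊥-elim (n q)

    nf-const : ∀ {x} (q q' : a ≡ x) → nf q ≡ nf q'
    nf-const {x} q q' with i x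
    ... | yes r = refl
    ... | no n = ⊥-elim (n q)

    key : ∀ {x} (q : a ≡ x) → q ≡ trans (sym (nf refl)) (nf q)
    key refl = sym (trans-symˡ (nf refl))

  isolated-loop : (p : a ≡ a) → p ≡ refl
  isolated-loop p =
    trans (key p) (trans (cong (trans (sym (nf refl))) (nf-const p refl))
                         (trans-symˡ (nf refl)))

Σ-path : ∀ {ℓ ℓ'} {A : Set ℓ} {B : A → Set ℓ'} {a a' : A} {b : B a} {b' : B a'}
       → _≡_ {A = Σ A B} (a , b) (a' , b') → Σ (a ≡ a') λ p → subst B p b ≡ b'
Σ-path refl = refl , refl

Σ-isolated : ∀ {ℓ ℓ'} {A : Set ℓ} {B : A → Set ℓ'} {a : A} {b : B a}
           → isIsolated a → isIsolated b → isIsolated {A = Σ A B} (a , b)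
Σ-isolated {B = B} {a} {b} i j (a' , b') with i a'
... | no ne = no λ q → ne (cong proj₁ q)
... | yes refl with j b'
...   | yes refl = yes refl
...   | no ne = no λ q → ne (lemma q)
  where
    lemma : _≡_ {A = Σ _ B} (a , b) (a , b') → b ≡ b'
    lemma q with Σ-path q
    ... | p , e = subst (λ p → subst B p b ≡ b') (isolated-loop i p) e

Σ-isolate : ∀ {ℓ ℓ'} (A : Set ℓ) (B : A → Set ℓ')
          → Σ (A °) (λ a → B (proj₁ a) °) → (Σ A B) °
Σ-isolate A B ((a , i) , (b , j)) = (a , b) , Σ-isolated i j

-- Identity types of A° are propositions: paths out of an isolated point are unique
-- (local Hedberg), and being isolated is a proposition under function
-- extensionality. So domain and codomain of Σ-isolate are sets, and between sets
-- every injective map is an embedding. Σ-isolate is injective because the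
-- isolatedness witnesses are determined by the underlying pair.
module Submission where

open import Defs
open import Level using (Level)
open import Data.Product using (Σ; _,_; proj₁)
open import Data.Product.Properties using (Σ-≡,≡→≡; Σ-≡,≡←≡; Σ-≡,≡↔≡)
open import Function.Bundles using (Inverse)
open import Function.Definitions using (Injective)
open import Relation.Nullary using (Irrelevant; Dec; yes; no; ¬_; contradiction)
open import Relation.Binary.PropositionalEquality
  using (_≡_; refl; sym; cong; cong₂; subst; module ≡-Reasoning)
open import Axiom.UniquenessOfIdentityProofs using (UIP; module Constant⇒UIP)

private
  variable
    ℓ ℓ′ : Level
    X A : Set ℓ
    Y : Set ℓ′
    B : A → Set ℓ′

Irrelevant⇒UIP : Irrelevant X → UIP X
Irrelevant⇒UIP irr = Constant⇒UIP.≡-irrelevant (λ {x} {y} _ → irr x y) (λ _ _ → refl)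

¬-irrelevant : FunExt → Irrelevant (¬ X)
¬-irrelevant fe ¬x ¬x′ = fe λ x → contradiction x ¬x

Dec-irrelevant : FunExt → Irrelevant X → Irrelevant (Dec X)
Dec-irrelevant fe irr (yes x) (yes x′) = cong yes (irr x x′)
Dec-irrelevant fe irr (yes x) (no ¬x′) = contradiction x ¬x′
Dec-irrelevant fe irr (no ¬x) (yes x′) = contradiction x′ ¬x
Dec-irrelevant fe irr (no ¬x) (no ¬x′) = cong no (¬-irrelevant fe ¬x ¬x′)

Σ-irrelevant : Irrelevant A → (∀ a → Irrelevant (B a)) → Irrelevant (Σ A B)
Σ-irrelevant irrA irrB (a , b) (a′ , b′) = Σ-≡,≡→≡ (irrA a a′ , irrB a′ _ b′)

Σ-≡-irrelevant : ∀ {a a′ : A} {b : B a} {b′ : B a′} →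
                 Irrelevant (a ≡ a′) →
                 (∀ (p : a ≡ a′) → Irrelevant (subst B p b ≡ b′)) →
                 Irrelevant (_≡_ {A = Σ A B} (a , b) (a′ , b′))
Σ-≡-irrelevant irr₁ irr₂ p q = begin
  p                    ≡⟨ sym (Inverse.strictlyInverseˡ Σ-≡,≡↔≡ p) ⟩
  Σ-≡,≡→≡ (Σ-≡,≡←≡ p)  ≡⟨ cong Σ-≡,≡→≡ (Σ-irrelevant irr₁ irr₂ _ _) ⟩
  Σ-≡,≡→≡ (Σ-≡,≡←≡ q)  ≡⟨ Inverse.strictlyInverseˡ Σ-≡,≡↔≡ q ⟩
  q                    ∎
  where open ≡-Reasoning

Σ-UIP : UIP A → (∀ a → UIP (B a)) → UIP (Σ A B)
Σ-UIP uipA uipB = Σ-≡-irrelevant uipA (λ _ → uipB _)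

⇔-irrelevant⇒isEquiv : Irrelevant X → Irrelevant Y → (Y → X) → (f : X → Y) → isEquiv f
⇔-irrelevant⇒isEquiv irrX irrY g f y =
  (g y , irrY _ y) , Σ-irrelevant irrX (λ _ → Irrelevant⇒UIP irrY) _

injective⇒isEmbedding : UIP X → UIP Y → (f : X → Y) → Injective _≡_ _≡_ f → isEmbedding f
injective⇒isEmbedding uipX uipY f inj x x′ = ⇔-irrelevant⇒isEquiv uipX uipY inj (cong f)

isolated-≡-irrelevant : {a x : A} → isIsolated a → Irrelevant (a ≡ x)
isolated-≡-irrelevant i p refl = isolated-loop i p

isIsolated-irrelevant : FunExt → (a : A) → Irrelevant (isIsolated a)
isIsolated-irrelevant fe a i i′ =
  fe λ b → Dec-irrelevant fe (isolated-≡-irrelevant i) (i b) (i′ b)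

°-UIP : FunExt → UIP (A °)
°-UIP fe {a , i} {a′ , i′} =
  Σ-≡-irrelevant (isolated-≡-irrelevant i) (λ _ → Irrelevant⇒UIP (isIsolated-irrelevant fe a′))

Σ-isolate-injective : FunExt → (A : Set ℓ) (B : A → Set ℓ′) → Injective _≡_ _≡_ (Σ-isolate A B)
Σ-isolate-injective fe A B {(a , i) , (b , j)} {(a′ , i′) , (b′ , j′)} q
  with cong proj₁ q
... | refl = cong₂ (λ i j → (a , i) , (b , j))
                   (isIsolated-irrelevant fe a i i′) (isIsolated-irrelevant fe b j j′)

proposition2p12 : FunExt → ∀ {ℓ ℓ'} (A : Set ℓ) (B : A → Set ℓ') → isEmbedding (Σ-isolate A B)
proposition2p12 fe A B =
  injective⇒isEmbedding (Σ-UIP (°-UIP fe) (λ _ → °-UIP fe)) (°-UIP fe)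
                        (Σ-isolate A B) (Σ-isolate-injective fe A B)
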